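{- Let $G$ be a finite simple connected graph and $\sigma$ a confined position of the parallel chip-firing game on $G$. Let the complement $\sigma_c$ be the position with $\sigma_c(v)=2\deg(v)-1-\sigma(v)$ for each vertex $v$. Then $U(\sigma_c)=(U\sigma)_c$.
   Context: Parallel chip-firing game on $G$: a position $\sigma$ assigns a nonnegative integer $\sigma(v)$ to each vertex. $\Phi_\sigma(v)$ is the number of neighbors $w$ of $v$ with $\sigma(w)\ge\deg(w)$ (firing neighbors). The step operator $U$: $U\sigma(v)=\sigma(v)+\Phi_\sigma(v)$ if $\sigma(v)\le\deg(v)-1$, and $U\sigma(v)=\sigma(v)+\Phi_\sigma(v)-\deg(v)$ if $\sigma(v)\ge\deg(v)$. A vertex $v$ is confined in $\sigma$ if $\Phi_\sigma(v)\le\sigma(v)\le\Phi_\sigma(v)+\deg(v)-1$; a position is confined if all its vertices are confined. -}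

module Defs where

open import Data.Nat using (ℕ; zero; suc; _+_; _*_; _∸_; _≤_; _<_; _≤ᵇ_)
open import Data.Bool using (Bool; true; false; _∧_; if_then_else_)
open import Data.Fin using (Fin)
open import Data.List using (List; filter; length; []; _∷_)
open import Data.List.Base using (allFin)
open import Data.Product using (_×_)
open import Relation.Binary.PropositionalEquality using (_≡_)
open import Relation.Nullary using (¬_)
open import Data.Bool.Properties using (T?)
open import Data.Bool using (T)

record Graph (n : ℕ) : Set where
  field
    adj   : Fin n → Fin n → Bool
    sym   : ∀ u v → adj u v ≡ adj v u
    irrefl : ∀ v → adj v v ≡ false
open Graph public

data Reach {n : ℕ} (G : Graph n) : Fin n → Fin n → Set where
  here : ∀ {v} → Reach G v v
  step : ∀ {u w v} → adj G u w ≡ true → Reach G w v → Reach G u v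

Connected : ∀ {n} → Graph n → Set
Connected G = ∀ u v → Reach G u v

countNbrs : ∀ {n} → Graph n → (Fin n → Bool) → Fin n → ℕ
countNbrs {n} G p v = length (filter (λ w → T? (adj G v w ∧ p w)) (allFin n))

deg : ∀ {n} → Graph n → Fin n → ℕ
deg G v = countNbrs G (λ _ → true) v

Position : ℕ → Set
Position n = Fin n → ℕ

fires : ∀ {n} → Graph n → Position n → Fin n → Bool
fires G σ w = deg G w ≤ᵇ σ w

Φ : ∀ {n} → Graph n → Position n → Fin n → ℕ
Φ G σ v = countNbrs G (fires G σ) v

U : ∀ {n} → Graph n → Position n → Position n
U G σ v = if fires G σ v
            then σ v + Φ G σ v ∸ deg G v
            else σ v + Φ G σ v

-- v confined: Φ ≤ σ(v) ≤ Φ + deg − 1 (upper bound written as σ(v) < Φ + deg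
-- to avoid truncated subtraction)
ConfinedAt : ∀ {n} → Graph n → Position n → Fin n → Set
ConfinedAt G σ v = (Φ G σ v ≤ σ v) × (σ v < Φ G σ v + deg G v)

Confined : ∀ {n} → Graph n → Position n → Set
Confined G σ = ∀ v → ConfinedAt G σ v

complement : ∀ {n} → Graph n → Position n → Position n
complement G σ v = 2 * deg G v ∸ 1 ∸ σ v

module Submission where

-- Locally, at a vertex of degree d with Φ firing neighbours, the step is
-- s ↦ localStep d Φ s and complementation is s ↦ comp d s = 2d − 1 − s.
-- Call two chip counts s, c *complementary at d* when s + c + 1 = 2d; for
-- s < 2d this says exactly c = comp d s.  The proof has three parts.
--  * Firing flips: of two complementary counts exactly one reaches d.  A
--    confined σ has σ(w) < Φ + deg ≤ 2 deg(w), so every vertex fires in σ_c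
--    iff it does not fire in σ.
--  * Counting: the neighbours of v split into those firing in σ and those
--    firing in σ_c, hence Φ_{σ_c}(v) + Φ_σ(v) = deg(v).
--  * Step duality: if s, c are complementary at d and φ_c + φ = d, then
--    localStep d φ s and localStep d φ_c c are again complementary; this is
--    pure arithmetic once we know which of s, c fires.
-- The theorem combines the three with the uniqueness of complements.

open import Defs hiding (sym)
open import Data.Nat using (ℕ; suc; _+_; _*_; _∸_; _≤_; _<_; _≤ᵇ_)
open import Data.Nat.Properties
open import Data.Nat.Tactic.RingSolver using (solve-∀)
open import Data.Bool using (Bool; true; false; _∧_; not; if_then_else_)
open import Data.Bool.Properties using (T?)
open import Data.Fin using (Fin)
open import Data.List using (List; []; _∷_; filter; length)
open import Data.List.Base using (allFin)
open import Data.Product using (proj₂)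
open import Relation.Nullary using (yes; no; ofʸ; ofⁿ; contradiction)
open import Relation.Binary.PropositionalEquality
  using (_≡_; refl; sym; trans; cong; cong₂; subst; module ≡-Reasoning)

count : ∀ {A : Set} → (A → Bool) → List A → ℕ
count b xs = length (filter (λ x → T? (b x)) xs)

count-complement : ∀ {A : Set} (a p q : A → Bool) → (∀ x → q x ≡ not (p x)) →
                   (xs : List A) →
                   count (λ x → a x ∧ p x) xs + count (λ x → a x ∧ q x) xs
                   ≡ count (λ x → a x ∧ true) xs
count-complement a p q q≡¬p [] = refl
count-complement a p q q≡¬p (x ∷ xs) with a x
... | false = count-complement a p q q≡¬p xs
... | true rewrite q≡¬p x with p x
...   | true  = cong suc (count-complement a p q q≡¬p xs)
...   | false = trans (+-suc _ _) (cong suc (count-complement a p q q≡¬p xs))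

countNbrs-complement : ∀ {n} (G : Graph n) (p q : Fin n → Bool) →
                       (∀ w → q w ≡ not (p w)) → ∀ v →
                       countNbrs G p v + countNbrs G q v ≡ deg G v
countNbrs-complement {n} G p q q≡¬p v =
  count-complement (adj G v) p q q≡¬p (allFin n)

Φ≤deg : ∀ {n} (G : Graph n) σ v → Φ G σ v ≤ deg G v
Φ≤deg G σ v = subst (Φ G σ v ≤_)
  (countNbrs-complement G (fires G σ) (λ w → not (fires G σ w)) (λ _ → refl) v)
  (m≤m+n _ _)

-- Confinement bounds every count strictly below twice the degree, which is
-- the range on which complementation is an involution without truncation.
confined⇒<2deg : ∀ {n} (G : Graph n) σ → Confined G σ → ∀ w → σ w < 2 * deg G w
confined⇒<2deg G σ conf w = begin-strict
  σ w                        <⟨ proj₂ (conf w) ⟩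
  Φ G σ w + deg G w          ≤⟨ +-monoˡ-≤ (deg G w) (Φ≤deg G σ w) ⟩
  deg G w + deg G w          ≡⟨ cong (deg G w +_) (sym (+-identityʳ (deg G w))) ⟩
  2 * deg G w                ∎
  where open ≤-Reasoning

-- The local rules at a vertex of degree d: by definition
-- complement G σ v = comp (deg G v) (σ v) and
-- U G σ v = localStep (deg G v) (Φ G σ v) (σ v).
comp : ℕ → ℕ → ℕ
comp d s = 2 * d ∸ 1 ∸ s

localStep : ℕ → ℕ → ℕ → ℕ
localStep d φ s = if d ≤ᵇ s then s + φ ∸ d else s + φ

-- s and c are complementary at d.  (A record, so that d, s, c can be
-- inferred from a proof.)
record Complementary (d s c : ℕ) : Set where
  constructor complementary
  field sum-eq : suc (s + c) ≡ 2 * d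

comp-complementary : ∀ d {s} → s < 2 * d → Complementary d s (comp d s)
comp-complementary d {s} s<2d = complementary (begin
  suc s + (2 * d ∸ 1 ∸ s)    ≡⟨ cong (suc s +_) (∸-+-assoc (2 * d) 1 s) ⟩
  suc s + (2 * d ∸ suc s)    ≡⟨ m+[n∸m]≡n s<2d ⟩
  2 * d                      ∎)
  where open ≡-Reasoning

comp-unique : ∀ {d s c} → Complementary d s c → comp d s ≡ c
comp-unique {d} {s} {c} (complementary sc) = begin
  2 * d ∸ 1 ∸ s              ≡⟨ ∸-+-assoc (2 * d) 1 s ⟩
  2 * d ∸ suc s              ≡⟨ cong (_∸ suc s) (sym sc) ⟩
  suc s + c ∸ suc s          ≡⟨ m+n∸m≡n (suc s) c ⟩
  c                          ∎
  where open ≡-Reasoning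

complementary-sym : ∀ {d s c} → Complementary d s c → Complementary d c s
complementary-sym {s = s} {c} (complementary sc) =
  complementary (trans (cong suc (+-comm c s)) sc)

fires⇒partner-quiet : ∀ {d s c} → Complementary d s c → d ≤ s → c < d
fires⇒partner-quiet {d} {s} {c} (complementary sc) d≤s =
  ≰⇒> λ d≤c → <⇒≱ s+c<2d (begin
  2 * d                      ≡⟨ cong (d +_) (+-identityʳ d) ⟩
  d + d                      ≤⟨ +-mono-≤ d≤s d≤c ⟩
  s + c                      ∎)
  where
  open ≤-Reasoning
  s+c<2d : s + c < 2 * d
  s+c<2d = subst (s + c <_) sc (n<1+n (s + c))

quiet⇒partner-fires : ∀ {d s c} → Complementary d s c → s < d → d ≤ c
quiet⇒partner-fires {d} {s} {c} (complementary sc) s<d =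
  ≮⇒≥ λ c<d → n≮n (2 * d) (begin-strict
  2 * d                      ≡⟨ sym sc ⟩
  suc (s + c)                <⟨ n<1+n (suc (s + c)) ⟩
  suc (suc (s + c))          ≡⟨ cong suc (sym (+-suc s c)) ⟩
  suc s + suc c              ≤⟨ +-mono-≤ s<d c<d ⟩
  d + d                      ≡⟨ cong (d +_) (sym (+-identityʳ d)) ⟩
  2 * d                      ∎)
  where open ≤-Reasoning

firing-flips : ∀ {d s c} → Complementary d s c → (d ≤ᵇ c) ≡ not (d ≤ᵇ s)
firing-flips {d} {s} {c} sc
  with d ≤ᵇ s | ≤ᵇ-reflects-≤ d s | d ≤ᵇ c | ≤ᵇ-reflects-≤ d c
... | true  | ofʸ _   | false | _       = refl
... | true  | ofʸ d≤s | true  | ofʸ d≤c =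
  contradiction d≤c (<⇒≱ (fires⇒partner-quiet sc d≤s))
... | false | ofⁿ _   | true  | _       = refl
... | false | ofⁿ d≰s | false | ofⁿ d≰c =
  contradiction (quiet⇒partner-fires sc (≰⇒> d≰s)) d≰c

fires-complement : ∀ {n} (G : Graph n) σ → Confined G σ →
                   ∀ w → fires G (complement G σ) w ≡ not (fires G σ w)
fires-complement G σ conf w =
  firing-flips (comp-complementary (deg G w) (confined⇒<2deg G σ conf w))

Φ-complement : ∀ {n} (G : Graph n) σ → Confined G σ →
               ∀ v → Φ G (complement G σ) v + Φ G σ v ≡ deg G v
Φ-complement G σ conf v = trans (+-comm (Φ G (complement G σ) v) (Φ G σ v))
  (countNbrs-complement G (fires G σ) (fires G (complement G σ))
                        (fires-complement G σ conf) v)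

localStep-fires : ∀ {d φ s} → d ≤ s → localStep d φ s ≡ s ∸ d + φ
localStep-fires {d} {φ} {s} d≤s with d ≤ᵇ s | ≤ᵇ-reflects-≤ d s
... | true  | _       = +-∸-comm φ d≤s
... | false | ofⁿ d≰s = contradiction d≤s d≰s

localStep-quiet : ∀ {d φ s} → s < d → localStep d φ s ≡ s + φ
localStep-quiet {d} {φ} {s} s<d with d ≤ᵇ s | ≤ᵇ-reflects-≤ d s
... | true  | ofʸ d≤s = contradiction d≤s (<⇒≱ s<d)
... | false | _       = refl

-- Step duality when s fires and its complement c is quiet: the chips s loses
-- beyond d are exactly the chips c gains from its φ_c = d − φ firing
-- neighbours, so the step preserves complementarity.
step-dual-fires : ∀ {d φ φc s c} → d ≤ s → c < d → φc + φ ≡ d →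
                  Complementary d s c →
                  Complementary d (localStep d φ s) (localStep d φc c)
step-dual-fires {d} {φ} {φc} {s} {c} d≤s c<d split (complementary sc) =
  complementary (begin
  suc (localStep d φ s + localStep d φc c)
    ≡⟨ cong₂ (λ x y → suc (x + y)) (localStep-fires d≤s) (localStep-quiet c<d) ⟩
  suc (s ∸ d + φ + (c + φc))  ≡⟨ cong suc (regroup (s ∸ d) φ c φc) ⟩
  suc (s ∸ d + (φc + φ) + c)  ≡⟨ cong (λ x → suc (s ∸ d + x + c)) split ⟩
  suc (s ∸ d + d + c)         ≡⟨ cong (λ x → suc (x + c)) (m∸n+n≡m d≤s) ⟩
  suc (s + c)                 ≡⟨ sc ⟩
  2 * d                       ∎)
  where
  open ≡-Reasoning
  regroup : ∀ t φ c φc → t + φ + (c + φc) ≡ t + (φc + φ) + c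
  regroup = solve-∀

-- Step duality in general: exactly one of s, c fires, and the other case is
-- the previous one with the roles of (s, φ) and (c, φc) exchanged.
step-dual : ∀ {d φ φc s c} → φc + φ ≡ d → Complementary d s c →
            Complementary d (localStep d φ s) (localStep d φc c)
step-dual {d} {φ} {φc} {s} {c} split sc with d ≤? s
... | yes d≤s = step-dual-fires d≤s (fires⇒partner-quiet sc d≤s) split sc
... | no  d≰s = complementary-sym
  (step-dual-fires (quiet⇒partner-fires sc s<d) s<d
                   (trans (+-comm φ φc) split) (complementary-sym sc))
  where
  s<d : s < d
  s<d = ≰⇒> d≰s

-- At v, σ(v) and σ_c(v) are complementary and their firing-neighbour counts
-- sum to deg v, so after one step U σ(v) and U σ_c(v) are complementary,
-- i.e. U σ_c(v) is the complement of U σ(v).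
lemma2p3 : ∀ {n} (G : Graph n) → Connected G → (σ : Position n) →
           Confined G σ →
           ∀ v → U G (complement G σ) v ≡ complement G (U G σ) v
lemma2p3 G _ σ conf v = sym (comp-unique (step-dual
  (Φ-complement G σ conf v)
  (comp-complementary (deg G v) (confined⇒<2deg G σ conf v))))
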